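{- Let $H$ be a graph of chromatic number $\ell\ge 2$ with $\chi_{cr}(H)<\ell$, let $B^*$ be its bottlegraph and $z,z_1$ as defined below. Let $D'\ge 0$ be an integer divisible by $|B^*|$. There exists $N$ such that the following holds. Let $G$ be a complete $\ell$-partite graph with vertex classes $U_1,\dots,U_\ell$ whose order $n\ge N$ is divisible by $|B^*|$, let $u_i:=|U_i|$, and suppose that for all $i<\ell$ the number $a_i:=z(n-\ell D')/|B^*|-(u_i-D')$ satisfies $0\le a_i\le n/(\ell^3|B^*|^2)$. Then one can delete the vertices of at most $\ell^2\sum_{i=1}^{\ell-1}a_i$ vertex-disjoint copies of $B^*$ in $G$ to obtain a subgraph $G^*\subseteq G$ such that, writing $n^*:=|G^*|$ and $u_i^*:=|U_i\cap V(G^*)|$, we have $\big|(u_i^*-D')-z(n^*-\ell D')/|B^*|\big|\le|B^*|$ for all $i<\ell$ and $\big|(u_\ell^*-D')-z_1(n^*-\ell D')/|B^*|\big|\le|B^*|$.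
   Context: For a graph $H$ with $\ell:=\chi(H)\ge 2$: $\sigma(H)$ is the minimum, over proper $\ell$-colourings of $H$, of the size of a smallest colour class; $\chi_{cr}(H):=(\ell-1)|H|/(|H|-\sigma(H))$; $z_1:=(\ell-1)\sigma(H)$, $z:=|H|-\sigma(H)$; the bottlegraph $B^*$ is the complete $\ell$-partite graph with one class of size $z_1$ and $\ell-1$ classes of size $z$. -}

module Defs where

open import Data.Nat as ℕ using (ℕ; zero; suc; _≤_; _<_; _∸_; pred)
open import Data.Integer as ℤ using (ℤ; +_)
open import Data.Rational.Unnormalised as ℚ using (ℚᵘ; mkℚᵘ; 0ℚᵘ)
open import Data.Fin as Fin using (Fin; zero; suc; toℕ; splitAt)
open import Data.Fin.Properties using (any?) renaming (_≟_ to _≟F_)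
open import Data.Bool using (Bool; true; false; if_then_else_; _∧_; not)
open import Data.Sum using (inj₁; inj₂)
open import Data.Product using (Σ; ∃; ∃-syntax; _×_; _,_)
open import Data.Empty using (⊥)
open import Relation.Nullary using (¬_)
open import Relation.Nullary.Decidable using (⌊_⌋)
open import Relation.Binary.PropositionalEquality using (_≡_; _≢_; refl; sym)
open import Function using (_∘_)
open import Function.Definitions using (Injective)

record Graph : Set₁ where
  field
    V      : ℕ
    E      : Fin V → Fin V → Set
    E-sym    : ∀ {x y} → E x y → E y x
    E-irrefl : ∀ {x} → ¬ E x x
open Graph public

count : ∀ {n} → (Fin n → Bool) → ℕ
count {zero}  P = 0
count {suc n} P = (if P zero then 1 else 0) ℕ.+ count (P ∘ suc)

ProperColouring : (H : Graph) (k : ℕ) → (Fin (V H) → Fin k) → Set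
ProperColouring H k f = ∀ x y → E H x y → f x ≢ f y

classSize : ∀ {m k} → (Fin m → Fin k) → Fin k → ℕ
classSize f i = count (λ x → ⌊ f x ≟F i ⌋)

IsChromaticNumber : Graph → ℕ → Set
IsChromaticNumber H ℓ =
  (∃[ f ] ProperColouring H ℓ f) ×
  (∀ k → k < ℓ → ¬ (∃[ f ] ProperColouring H k f))

-- σ(H) = s, where ℓ = χ(H): s is the minimum, over proper ℓ-colourings f,
-- of the size of a smallest colour class of f (i.e. minimum over pairs (f , i)).
IsSigma : Graph → ℕ → ℕ → Set
IsSigma H ℓ s =
  (∃[ f ] (ProperColouring H ℓ f × ∃[ i ] classSize f i ≡ s)) ×
  (∀ f → ProperColouring H ℓ f → ∀ i → s ≤ classSize f i)

ℕ→ℚ : ℕ → ℚᵘ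
ℕ→ℚ n = mkℚᵘ (+ n) 0

ℤ→ℚ : ℤ → ℚᵘ
ℤ→ℚ p = mkℚᵘ p 0

-- p ÷ d as a rational; only used with d ≥ 1 (then it is exactly p/d)
frac : ℤ → ℕ → ℚᵘ
frac p d = mkℚᵘ p (pred d)

ΣQ : ∀ {m} → (Fin m → ℚᵘ) → ℚᵘ
ΣQ {zero}  f = 0ℚᵘ
ΣQ {suc m} f = f zero ℚ.+ ΣQ (f ∘ suc)

χcr : (H : Graph) (ℓ σ : ℕ) → ℚᵘ
χcr H ℓ σ = frac (+ ((ℓ ∸ 1) ℕ.* V H)) (V H ∸ σ)

CompleteMultipartite : (n k : ℕ) → (Fin n → Fin k) → Graph
CompleteMultipartite n k c = record
  { V = n ; E = λ x y → c x ≢ c y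
  ; E-sym = λ p q → p (sym q) ; E-irrefl = λ p → p refl }

sumF : (k : ℕ) → (Fin k → ℕ) → ℕ
sumF zero    s = 0
sumF (suc k) s = s zero ℕ.+ sumF k (s ∘ suc)

classOf : (k : ℕ) (s : Fin k → ℕ) → Fin (sumF k s) → Fin k
classOf (suc k) s x with splitAt (s zero) x
... | inj₁ _ = zero
... | inj₂ y = suc (classOf k (s ∘ suc) y)

CompleteMultipartiteSizes : (k : ℕ) → (Fin k → ℕ) → Graph
CompleteMultipartiteSizes k s = CompleteMultipartite (sumF k s) k (classOf k s)

bottleSizes : (ℓ z z1 : ℕ) → Fin ℓ → ℕ
bottleSizes ℓ z z1 zero    = z1
bottleSizes ℓ z z1 (suc _) = z

Bottle : (H : Graph) (ℓ σ : ℕ) → Graph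
Bottle H ℓ σ = CompleteMultipartiteSizes ℓ (bottleSizes ℓ (V H ∸ σ) ((ℓ ∸ 1) ℕ.* σ))

-- Copies (not necessarily induced subgraphs) of F in G: injective homomorphisms

IsCopy : (F G : Graph) → (Fin (V F) → Fin (V G)) → Set
IsCopy F G φ = Injective _≡_ _≡_ φ × (∀ x y → E F x y → E G (φ x) (φ y))

survives : ∀ {k a n} → (Fin k → Fin a → Fin n) → Fin n → Bool
survives {k} {a} φ x = not ⌊ any? (λ j → any? (λ v → φ j v ≟F x)) ⌋

{-# OPTIONS --safe #-}
module Submission where

open import Defs
open import Data.Nat as ℕ using (ℕ; zero; suc; _+_; _*_; _^_; _≤_; _<_; _∸_; _<ᵇ_; z≤n; s≤s; NonZero; _/_; _%_)
import Data.Nat.Properties as ℕ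
import Data.Nat.DivMod as ℕ
open import Data.Nat.Divisibility using (_∣_; divides)
open import Data.Nat.Tactic.RingSolver using (solve-∀)
open import Data.Integer as ℤ using (+_; _⊖_)
import Data.Integer.Properties as ℤ
import Data.Integer.Tactic.RingSolver as ℤ-Solver
open import Data.Rational.Unnormalised as ℚ using (ℚᵘ; 0ℚᵘ; *≡*; *≤*; *<*)
import Data.Rational.Unnormalised.Properties as ℚ
open import Data.Fin as Fin using (Fin; zero; suc; toℕ; fromℕ; _↑ˡ_; _↑ʳ_; splitAt; punchIn)
open import Data.Fin.Properties using (_≟_; any?; toℕ-fromℕ; toℕ-injective; toℕ<n; suc-injective; splitAt-↑ˡ; splitAt-↑ʳ; splitAt⁻¹-↑ˡ; splitAt⁻¹-↑ʳ; ↑ˡ-injective; ↑ʳ-injective; punchIn-injective; punchInᵢ≢i; punchIn-punchOut; punchOut-injective)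
open import Data.Fin.Permutation using (Permutation; _⟨$⟩ʳ_; _⟨$⟩ˡ_; inverseˡ; inverseʳ; transpose)
import Data.Fin.Permutation.Components as PC
open import Data.Bool using (Bool; true; false; if_then_else_; _∧_; not; T)
open import Data.Bool.Properties using (∧-identityʳ)
open import Data.Sum using (_⊎_; inj₁; inj₂)
open import Data.Product using (Σ; ∃-syntax; _×_; _,_; proj₁; proj₂)
open import Relation.Nullary using (¬_; yes; no; contradiction; Reflects; ofʸ; ofⁿ)
open import Relation.Nullary.Decidable using (⌊_⌋; ⌊⌋-map′; toWitness)
open import Relation.Binary.PropositionalEquality using (_≡_; _≢_; refl; sym; trans; cong; cong₂; subst; subst₂; module ≡-Reasoning)
open import Function using (_∘_)
open import Function.Bundles using (Injection)
open import Function.Definitions using (Injective)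
open import Function.Properties.Inverse using (↔⇒↣)
open import Algebra.Properties.CommutativeSemigroup ℕ.+-commutativeSemigroup using (x∙yz≈y∙xz)
open import Algebra.Properties.Semiring.Sum ℕ.+-*-semiring using (sum; sum-cong-≗; ∑-distrib-+; *-distribʳ-sum)

-- Take
-- N = 2ℓD′ and write n = ℓD′ + Q|B*|, so that z(n − ℓD′)/|B*| = zQ and the deficit of U_i
-- (i < ℓ) is a_i = D′ + zQ − u_i. Write a_i = m_i(z − z₁) + r_i with r_i < z − z₁. A copy of
-- B* whose z₁-class lies in U_i takes z₁ vertices from U_i and z from every other class, so
-- deleting m_i such copies for each i < ℓ, k = Σ m_i ≤ Σ a_i copies in all, leaves U_i
-- exactly r_i short of D′ + z(Q − k) and U_ℓ exactly Σ r_i above D′ + z₁(Q − k), both at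
-- most |B*|. As a_i ≤ n/(ℓ³|B*|²), the copies use only a small part of each class, so they
-- can be taken vertex-disjoint.

sumF≡sum : ∀ k (s : Fin k → ℕ) → sumF k s ≡ sum s
sumF≡sum zero    s = refl
sumF≡sum (suc k) s = cong (_+_ (s zero)) (sumF≡sum k (s ∘ suc))

sum-const : ∀ n x → sum {n} (λ _ → x) ≡ n * x
sum-const zero    x = refl
sum-const (suc n) x = cong (_+_ x) (sum-const n x)

sum-mono-≤ : ∀ {n} {f g : Fin n → ℕ} → (∀ i → f i ≤ g i) → sum f ≤ sum g
sum-mono-≤ {zero}  f≤g = z≤n
sum-mono-≤ {suc n} f≤g = ℕ.+-mono-≤ (f≤g zero) (sum-mono-≤ (f≤g ∘ suc))

term≤sum : ∀ {n} (f : Fin n → ℕ) i → f i ≤ sum f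
term≤sum f zero    = ℕ.m≤m+n _ _
term≤sum f (suc i) = ℕ.≤-trans (term≤sum (f ∘ suc) i) (ℕ.m≤n+m _ _)

sum-indicator : ∀ {n} (f : Fin n → ℕ) i → sum (λ t → if ⌊ t ≟ i ⌋ then f t else 0) ≡ f i
sum-indicator {suc n} f zero    = trans (cong (_+_ (f zero)) (trans (sum-const n 0) (ℕ.*-zeroʳ n))) (ℕ.+-identityʳ _)
sum-indicator {suc n} f (suc i) =
  trans (sum-cong-≗ (λ t → cong (if_then f (suc t) else 0) (⌊⌋-map′ _ _ (t ≟ i)))) (sum-indicator (f ∘ suc) i)

sum-↑ : ∀ m {n} (f : Fin (m + n) → ℕ) → sum f ≡ sum (f ∘ (_↑ˡ n)) + sum (f ∘ (m ↑ʳ_))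
sum-↑ zero    f = refl
sum-↑ (suc m) f = trans (cong (_+_ (f zero)) (sum-↑ m (f ∘ suc))) (sym (ℕ.+-assoc (f zero) _ _))

𝟙 : Bool → ℕ
𝟙 b = if b then 1 else 0

count-sum : ∀ {n} (P : Fin n → Bool) → count P ≡ sum (𝟙 ∘ P)
count-sum {zero}  P = refl
count-sum {suc n} P = cong (_+_ (𝟙 (P zero))) (count-sum (P ∘ suc))

count-cong : ∀ {n} {P Q : Fin n → Bool} → (∀ x → P x ≡ Q x) → count P ≡ count Q
count-cong {zero}  P≗Q = refl
count-cong {suc n} P≗Q = cong₂ _+_ (cong 𝟙 (P≗Q zero)) (count-cong (P≗Q ∘ suc))

count-true : ∀ n → count {n} (λ _ → true) ≡ n
count-true zero    = refl
count-true (suc n) = cong suc (count-true n)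

count-∧-not : ∀ {n} (P Q : Fin n → Bool) → count (λ x → P x ∧ Q x) + count (λ x → not (P x) ∧ Q x) ≡ count Q
count-∧-not {zero}  P Q = refl
count-∧-not {suc n} P Q with P zero | Q zero | count-∧-not (P ∘ suc) (Q ∘ suc)
... | true  | true  | eq = cong suc eq
... | true  | false | eq = eq
... | false | true  | eq = trans (ℕ.+-suc _ _) (cong suc eq)
... | false | false | eq = eq

count-punchIn : ∀ {n} (P : Fin (suc n) → Bool) x₀ → count P ≡ 𝟙 (P x₀) + count (P ∘ punchIn x₀)
count-punchIn P zero = refl
count-punchIn {suc n} P (suc x₀) =
  trans (cong (_+_ (𝟙 (P zero))) (count-punchIn (P ∘ suc) x₀)) (x∙yz≈y∙xz (𝟙 (P zero)) (𝟙 (P (suc x₀))) _)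

count-witness : ∀ {n} (P : Fin n → Bool) → 0 < count P → Σ (Fin n) λ x → T (P x)
count-witness {suc n} P 0<count with P zero in P₀
... | true  = zero , subst T (sym P₀) _
... | false with count-witness (P ∘ suc) 0<count
...   | x , Px = suc x , Px

count-≤-injection : ∀ {m n} (P : Fin m → Bool) (Q : Fin n → Bool) (h : ∀ x → P x ≡ true → Fin n) →
  (∀ x p → Q (h x p) ≡ true) → (∀ x p x′ p′ → h x p ≡ h x′ p′ → x ≡ x′) → count P ≤ count Q
count-≤-injection {zero} P Q h Qh h-inj = z≤n
count-≤-injection {suc m} P Q h Qh h-inj with P zero in P₀
... | false = count-≤-injection (P ∘ suc) Q (h ∘ suc) (Qh ∘ suc) (λ x p x′ p′ → suc-injective ∘ h-inj (suc x) p (suc x′) p′)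
count-≤-injection {suc m} {zero} P Q h Qh h-inj | true with h zero P₀
... | ()
count-≤-injection {suc m} {suc n} P Q h Qh h-inj | true = begin
  suc (count (P ∘ suc))                  ≤⟨ s≤s (count-≤-injection (P ∘ suc) (Q ∘ punchIn y₀) h′ Qh′ h′-inj) ⟩
  suc (count (Q ∘ punchIn y₀))           ≡⟨ cong (λ b → 𝟙 b + count (Q ∘ punchIn y₀)) (Qh zero P₀) ⟨
  𝟙 (Q y₀) + count (Q ∘ punchIn y₀)      ≡⟨ count-punchIn Q y₀ ⟨
  count Q                                ∎
  where
  open ℕ.≤-Reasoning
  y₀ = h zero P₀
  y₀≢ : ∀ x p → y₀ ≢ h (suc x) p
  y₀≢ x p e with h-inj zero P₀ (suc x) p e
  ... | ()
  h′ : ∀ x → P (suc x) ≡ true → Fin n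
  h′ x p = Fin.punchOut (y₀≢ x p)
  Qh′ : ∀ x p → Q (punchIn y₀ (h′ x p)) ≡ true
  Qh′ x p rewrite punchIn-punchOut (y₀≢ x p) = Qh (suc x) p
  h′-inj : ∀ x p x′ p′ → h′ x p ≡ h′ x′ p′ → x ≡ x′
  h′-inj x p x′ p′ e = suc-injective (h-inj (suc x) p (suc x′) p′ (punchOut-injective (y₀≢ x p) (y₀≢ x′ p′) e))

count-image : ∀ {m n} (g : Fin m → Fin n) → Injective _≡_ _≡_ g → (P : Fin n → Bool) (Q : Fin m → Bool) →
  (∀ x → P x ≡ true → Σ (Fin m) λ y → g y ≡ x × Q y ≡ true) → (∀ y → Q y ≡ true → P (g y) ≡ true) → count P ≡ count Q
count-image g g-injective P Q P⊆gQ gQ⊆P = ℕ.≤-antisym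
  (count-≤-injection P Q (λ x p → proj₁ (P⊆gQ x p)) (λ x p → proj₂ (proj₂ (P⊆gQ x p)))
    (λ x p x′ p′ e → trans (sym (proj₁ (proj₂ (P⊆gQ x p)))) (trans (cong g e) (proj₁ (proj₂ (P⊆gQ x′ p′))))))
  (count-≤-injection Q P (λ y _ → g y) gQ⊆P (λ y _ y′ _ → g-injective))

sum-𝟙-≟ : ∀ {ℓ} (y : Fin ℓ) → sum (λ i → 𝟙 ⌊ y ≟ i ⌋) ≡ 1
sum-𝟙-≟ {suc ℓ} zero    = cong suc (trans (sum-const ℓ 0) (ℕ.*-zeroʳ ℓ))
sum-𝟙-≟ {suc ℓ} (suc y) = trans (sum-cong-≗ (λ i → cong 𝟙 (⌊⌋-map′ _ _ (y ≟ i)))) (sum-𝟙-≟ y)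

sum-classSize : ∀ {ℓ n} (c : Fin n → Fin ℓ) → sum (classSize c) ≡ n
sum-classSize {ℓ} {zero}  c = trans (sum-const ℓ 0) (ℕ.*-zeroʳ ℓ)
sum-classSize {ℓ} {suc n} c =
  trans (∑-distrib-+ (λ i → 𝟙 ⌊ c zero ≟ i ⌋) (classSize (c ∘ suc))) (cong₂ _+_ (sum-𝟙-≟ (c zero)) (sum-classSize (c ∘ suc)))

notLast : ∀ {ℓ} → Fin ℓ → Bool
notLast {ℓ} i = suc (toℕ i) <ᵇ ℓ

notLast-reflects : ∀ {ℓ} (i : Fin ℓ) → Reflects (suc (toℕ i) < ℓ) (notLast i)
notLast-reflects {ℓ} i = ℕ.<ᵇ-reflects-< (suc (toℕ i)) ℓ

≡⇒last : ∀ {L} (i : Fin (suc L)) → suc (toℕ i) ≡ suc L → i ≡ fromℕ L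
≡⇒last {L} i i≡L = toℕ-injective (trans (ℕ.suc-injective i≡L) (sym (toℕ-fromℕ L)))

notLast-or-last : ∀ {L} (i : Fin (suc L)) → suc (toℕ i) < suc L ⊎ i ≡ fromℕ L
notLast-or-last {L} i with suc (toℕ i) ℕ.<? suc L
... | yes i<L = inj₁ i<L
... | no  i≮L = inj₂ (≡⇒last i (ℕ.≤-antisym (toℕ<n i) (ℕ.≮⇒≥ i≮L)))

sum-notLast : ∀ L (f : Fin (suc L) → ℕ) → sum f ≡ sum (λ i → if notLast i then f i else 0) + f (fromℕ L)
sum-notLast zero    f = ℕ.+-comm (f zero) 0
sum-notLast (suc L) f = trans (cong (_+_ (f zero)) (sum-notLast L (f ∘ suc))) (sym (ℕ.+-assoc (f zero) _ _))

sum-notLast-const : ∀ L x → sum {suc L} (λ i → if notLast i then x else 0) ≡ L * x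
sum-notLast-const L x = ℕ.+-cancelʳ-≡ x _ _ (begin
  sum {suc L} (λ i → if notLast i then x else 0) + x  ≡⟨ sum-notLast L (λ _ → x) ⟨
  sum {suc L} (λ _ → x)                               ≡⟨ sum-const (suc L) x ⟩
  x + L * x                                           ≡⟨ ℕ.+-comm x (L * x) ⟩
  L * x + x                                           ∎)
  where open ≡-Reasoning

ι : ∀ k (s : Fin k → ℕ) (j : Fin k) → Fin (s j) → Fin (sumF k s)
ι (suc k) s zero    v = v ↑ˡ sumF k (s ∘ suc)
ι (suc k) s (suc j) v = s zero ↑ʳ ι k (s ∘ suc) j v

classOf-ι : ∀ k (s : Fin k → ℕ) j v → classOf k s (ι k s j v) ≡ j
classOf-ι (suc k) s zero    v rewrite splitAt-↑ˡ (s zero) v (sumF k (s ∘ suc)) = refl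
classOf-ι (suc k) s (suc j) v rewrite splitAt-↑ʳ (s zero) (sumF k (s ∘ suc)) (ι k (s ∘ suc) j v) =
  cong suc (classOf-ι k (s ∘ suc) j v)

ι-block-injective : ∀ k (s : Fin k → ℕ) {j j′} v v′ → ι k s j v ≡ ι k s j′ v′ → j ≡ j′
ι-block-injective k s {j} {j′} v v′ e = trans (sym (classOf-ι k s j v)) (trans (cong (classOf k s) e) (classOf-ι k s j′ v′))

ι-injective : ∀ k (s : Fin k → ℕ) j → Injective _≡_ _≡_ (ι k s j)
ι-injective (suc k) s zero    e = ↑ˡ-injective _ _ _ e
ι-injective (suc k) s (suc j) e = ι-injective k (s ∘ suc) j (↑ʳ-injective (s zero) _ _ e)

ι-surjective : ∀ k (s : Fin k → ℕ) x → Σ (Fin k) λ j → Σ (Fin (s j)) λ v → ι k s j v ≡ x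
ι-surjective (suc k) s x with splitAt (s zero) x in eq
... | inj₁ v = zero , v , splitAt⁻¹-↑ˡ eq
... | inj₂ y with ι-surjective k (s ∘ suc) y
...   | j , v , ιv≡y = suc j , v , trans (cong (s zero ↑ʳ_) ιv≡y) (splitAt⁻¹-↑ʳ eq)

blockwise : ∀ {A : Set} k (s : Fin k → ℕ) → ((j : Fin k) → Fin (s j) → A) → Fin (sumF k s) → A
blockwise (suc k) s f x with splitAt (s zero) x
... | inj₁ v = f zero v
... | inj₂ y = blockwise k (s ∘ suc) (f ∘ suc) y

blockwise-ι : ∀ {A : Set} k (s : Fin k → ℕ) (f : (j : Fin k) → Fin (s j) → A) j v → blockwise k s f (ι k s j v) ≡ f j v
blockwise-ι (suc k) s f zero    v rewrite splitAt-↑ˡ (s zero) v (sumF k (s ∘ suc)) = refl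
blockwise-ι (suc k) s f (suc j) v rewrite splitAt-↑ʳ (s zero) (sumF k (s ∘ suc)) (ι k (s ∘ suc) j v) =
  blockwise-ι k (s ∘ suc) (f ∘ suc) j v

sum-ι : ∀ k (s : Fin k → ℕ) (f : Fin (sumF k s) → ℕ) → sum f ≡ sum (λ j → sum (f ∘ ι k s j))
sum-ι zero    s f = refl
sum-ι (suc k) s f = trans (sum-↑ (s zero) f) (cong (_+_ (sum (f ∘ (_↑ˡ sumF k (s ∘ suc))))) (sum-ι k (s ∘ suc) _))

classSize-blockwise : ∀ {ℓ} k (s : Fin k → ℕ) (f : (j : Fin k) → Fin (s j) → Fin ℓ) i →
  classSize (blockwise k s f) i ≡ sum (λ j → classSize (f j) i)
classSize-blockwise k s f i = begin
  classSize (blockwise k s f) i                                  ≡⟨ count-sum (λ y → ⌊ blockwise k s f y ≟ i ⌋) ⟩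
  sum (λ y → 𝟙 ⌊ blockwise k s f y ≟ i ⌋)                       ≡⟨ sum-ι k s _ ⟩
  sum (λ j → sum (λ v → 𝟙 ⌊ blockwise k s f (ι k s j v) ≟ i ⌋)) ≡⟨ sum-cong-≗ block ⟩
  sum (λ j → classSize (f j) i)                                  ∎
  where
  open ≡-Reasoning
  block : ∀ j → sum (λ v → 𝟙 ⌊ blockwise k s f (ι k s j v) ≟ i ⌋) ≡ classSize (f j) i
  block j = trans (sum-cong-≗ (λ v → cong (λ y → 𝟙 ⌊ y ≟ i ⌋) (blockwise-ι k s f j v))) (sym (count-sum (λ v → ⌊ f j v ≟ i ⌋)))

classSize-classOf : ∀ k (s : Fin k → ℕ) j → classSize (classOf k s) j ≡ s j
classSize-classOf k s j = begin
  classSize (classOf k s) j                                    ≡⟨ count-sum (λ x → ⌊ classOf k s x ≟ j ⌋) ⟩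
  sum (λ x → 𝟙 ⌊ classOf k s x ≟ j ⌋)                        ≡⟨ sum-ι k s _ ⟩
  sum (λ t → sum (λ v → 𝟙 ⌊ classOf k s (ι k s t v) ≟ j ⌋))  ≡⟨ sum-cong-≗ block ⟩
  sum (λ t → if ⌊ t ≟ j ⌋ then s t else 0)                    ≡⟨ sum-indicator s j ⟩
  s j                                                          ∎
  where
  open ≡-Reasoning
  block : ∀ t → sum (λ v → 𝟙 ⌊ classOf k s (ι k s t v) ≟ j ⌋) ≡ (if ⌊ t ≟ j ⌋ then s t else 0)
  block t = trans (sum-cong-≗ (λ v → cong (λ u → 𝟙 ⌊ u ≟ j ⌋) (classOf-ι k s t v))) (trans (sum-const (s t) _) (by-cases ⌊ t ≟ j ⌋))
    where
    by-cases : ∀ b → s t * 𝟙 b ≡ (if b then s t else 0)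
    by-cases true  = ℕ.*-identityʳ (s t)
    by-cases false = ℕ.*-zeroʳ (s t)

classSize-permute : ∀ {ℓ m} (ρ : Permutation ℓ ℓ) (f : Fin m → Fin ℓ) i →
  classSize (λ x → ρ ⟨$⟩ʳ f x) i ≡ classSize f (ρ ⟨$⟩ˡ i)
classSize-permute ρ f i = count-cong (λ x → ≟-permute (f x))
  where
  ≟-permute : ∀ y → ⌊ ρ ⟨$⟩ʳ y ≟ i ⌋ ≡ ⌊ y ≟ ρ ⟨$⟩ˡ i ⌋
  ≟-permute y with ρ ⟨$⟩ʳ y ≟ i | y ≟ ρ ⟨$⟩ˡ i
  ... | yes _    | yes _  = refl
  ... | no  _    | no  _  = refl
  ... | yes ρy≡i | no y≢  = contradiction (trans (sym (inverseˡ ρ)) (cong (ρ ⟨$⟩ˡ_) ρy≡i)) y≢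
  ... | no ρy≢   | yes y≡ = contradiction (trans (cong (ρ ⟨$⟩ʳ_) y≡) (inverseʳ ρ)) ρy≢

class-preserving-injection : ∀ {ℓ m n} (κ : Fin m → Fin ℓ) (c : Fin n → Fin ℓ) →
  (∀ i → classSize κ i ≤ classSize c i) →
  Σ (Fin m → Fin n) λ Φ → Injective _≡_ _≡_ Φ × (∀ y → c (Φ y) ≡ κ y)
class-preserving-injection {m = zero} κ c κ≤c = (λ ()) , (λ {}) , (λ ())
class-preserving-injection {ℓ} {suc m} {n} κ c κ≤c
  with count-witness (λ x → ⌊ c x ≟ κ zero ⌋) (ℕ.≤-trans κ₀-occurs (κ≤c (κ zero)))
  where
  κ₀-occurs : 0 < classSize κ (κ zero)
  κ₀-occurs with κ zero ≟ κ zero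
  ... | yes _    = s≤s z≤n
  ... | no κ₀≢κ₀ = contradiction refl κ₀≢κ₀
class-preserving-injection {ℓ} {suc m} {suc n} κ c κ≤c | x₀ , cx₀≟κ₀ = Φ , Φ-injective , Φ-class
  where
  cx₀≡κ₀ : c x₀ ≡ κ zero
  cx₀≡κ₀ = toWitness cx₀≟κ₀
  κ′≤c′ : ∀ i → classSize (κ ∘ suc) i ≤ classSize (c ∘ punchIn x₀) i
  κ′≤c′ i = ℕ.+-cancelˡ-≤ (𝟙 ⌊ κ zero ≟ i ⌋) _ _ (subst (classSize κ i ≤_) c-split (κ≤c i))
    where
    c-split : classSize c i ≡ 𝟙 ⌊ κ zero ≟ i ⌋ + classSize (c ∘ punchIn x₀) i
    c-split = trans (count-punchIn (λ x → ⌊ c x ≟ i ⌋) x₀) (cong (λ y → 𝟙 ⌊ y ≟ i ⌋ + _) cx₀≡κ₀)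
  rest = class-preserving-injection (κ ∘ suc) (c ∘ punchIn x₀) κ′≤c′
  Φ : Fin (suc m) → Fin (suc n)
  Φ zero    = x₀
  Φ (suc y) = punchIn x₀ (proj₁ rest y)
  Φ-injective : Injective _≡_ _≡_ Φ
  Φ-injective {zero}  {zero}   _ = refl
  Φ-injective {zero}  {suc y′} e = contradiction (sym e) (punchInᵢ≢i x₀ _)
  Φ-injective {suc y} {zero}   e = contradiction e (punchInᵢ≢i x₀ _)
  Φ-injective {suc y} {suc y′} e = cong suc (proj₁ (proj₂ rest) (punchIn-injective x₀ _ _ e))
  Φ-class : ∀ y → c (Φ y) ≡ κ y
  Φ-class zero    = cx₀≡κ₀
  Φ-class (suc y) = proj₂ (proj₂ rest) y

-- Packing disjoint copies

¬survives⇒covered : ∀ {k a n} (φ : Fin k → Fin a → Fin n) x → survives φ x ≡ false →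
  Σ (Fin k) λ j → Σ (Fin a) λ v → φ j v ≡ x
¬survives⇒covered φ x _ with any? (λ j → any? (λ v → φ j v ≟ x))
... | yes (j , v , φjv≡x) = j , v , φjv≡x

covered⇒¬survives : ∀ {k a n} (φ : Fin k → Fin a → Fin n) j v → survives φ (φ j v) ≡ false
covered⇒¬survives φ j v with any? (λ j′ → any? (λ v′ → φ j′ v′ ≟ φ j v))
... | yes _       = refl
... | no ¬covered = contradiction (j , v , refl) ¬covered

count-survivors : ∀ {k a n} (Φ : Fin (sumF k (λ _ → a)) → Fin n) → Injective _≡_ _≡_ Φ → (Q : Fin n → Bool) →
  let φ = λ j v → Φ (ι k (λ _ → a) j v)
  in count (λ x → survives φ x ∧ Q x) + count (Q ∘ Φ) ≡ count Q
count-survivors {k} {a} Φ Φ-injective Q =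
  trans (cong (_+_ (count (λ x → survives φ x ∧ Q x))) (sym removed)) (count-∧-not (survives φ) Q)
  where
  φ : Fin k → Fin a → _
  φ j v = Φ (ι k (λ _ → a) j v)
  removed⊆Φ : ∀ x → not (survives φ x) ∧ Q x ≡ true → Σ (Fin (sumF k (λ _ → a))) λ y → Φ y ≡ x × Q (Φ y) ≡ true
  removed⊆Φ x p with survives φ x in sx | Q x in Qx
  ... | false | true with ¬survives⇒covered φ x sx
  ...   | j , v , φjv≡x = ι k (λ _ → a) j v , φjv≡x , trans (cong Q φjv≡x) Qx
  Φ⊆removed : ∀ y → Q (Φ y) ≡ true → not (survives φ (Φ y)) ∧ Q (Φ y) ≡ true
  Φ⊆removed y QΦy with ι-surjective k (λ _ → a) y
  ... | j , v , refl rewrite covered⇒¬survives φ j v = QΦy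
  removed : count (λ x → not (survives φ x) ∧ Q x) ≡ count (Q ∘ Φ)
  removed = count-image Φ Φ-injective _ (Q ∘ Φ) removed⊆Φ Φ⊆removed

pack-permuted-copies : ∀ {ℓ k n} (S : Fin ℓ → ℕ) (ρ : Fin k → Permutation ℓ ℓ) (c : Fin n → Fin ℓ)
  (demand : Fin ℓ → ℕ) → (∀ i → sum (λ j → S (ρ j ⟨$⟩ˡ i)) ≡ demand i) →
  let b = sumF ℓ S
  in (∀ i → demand i ≤ classSize c i) →
  Σ (Fin k → Fin b → Fin n) λ φ →
    (∀ j → IsCopy (CompleteMultipartiteSizes ℓ S) (CompleteMultipartite n ℓ c) (φ j)) ×
    (∀ j j′ → j ≢ j′ → ∀ v v′ → φ j v ≢ φ j′ v′) ×
    (count (survives φ) + k * b ≡ n) ×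
    (∀ i → count (λ x → survives φ x ∧ ⌊ c x ≟ i ⌋) + demand i ≡ classSize c i)
pack-permuted-copies {ℓ} {k} {n} S ρ c demand demand≡ demand≤c = φ , copy , disjoint , survivors , survivors-in
  where
  b = sumF ℓ S
  blocks : Fin k → ℕ
  blocks _ = b
  copy-class : (j : Fin k) → Fin b → Fin ℓ
  copy-class j v = ρ j ⟨$⟩ʳ classOf ℓ S v
  κ-demand : ∀ i → classSize (blockwise k blocks copy-class) i ≡ demand i
  κ-demand i = trans (classSize-blockwise k blocks copy-class i) (trans (sum-cong-≗ λ j →
    trans (classSize-permute (ρ j) (classOf ℓ S) i) (classSize-classOf ℓ S (ρ j ⟨$⟩ˡ i))) (demand≡ i))
  embedding = class-preserving-injection (blockwise k blocks copy-class) c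
    (λ i → subst (_≤ classSize c i) (sym (κ-demand i)) (demand≤c i))
  Φ = proj₁ embedding
  Φ-injective = proj₁ (proj₂ embedding)
  φ : Fin k → Fin b → Fin n
  φ j v = Φ (ι k blocks j v)
  φ-class : ∀ j v → c (φ j v) ≡ copy-class j v
  φ-class j v = trans (proj₂ (proj₂ embedding) _) (blockwise-ι k blocks copy-class j v)
  copy : ∀ j → IsCopy (CompleteMultipartiteSizes ℓ S) (CompleteMultipartite n ℓ c) (φ j)
  copy j = ι-injective k blocks j ∘ Φ-injective , λ x y classes≢ →
    classes≢ ∘ Injection.injective (↔⇒↣ (ρ j)) ∘ λ e → trans (sym (φ-class j x)) (trans e (φ-class j y))
  disjoint : ∀ j j′ → j ≢ j′ → ∀ v v′ → φ j v ≢ φ j′ v′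
  disjoint j j′ j≢j′ v v′ = j≢j′ ∘ ι-block-injective k blocks v v′ ∘ Φ-injective
  survivors : count (survives φ) + k * b ≡ n
  survivors = begin
    count (survives φ) + k * b                                             ≡⟨ cong₂ _+_ (count-cong (λ x → ∧-identityʳ (survives φ x))) removed-all ⟨
    count (λ x → survives φ x ∧ true) + count {sumF k blocks} (λ _ → true)  ≡⟨ count-survivors Φ Φ-injective (λ _ → true) ⟩
    count {n} (λ _ → true)                                                 ≡⟨ count-true n ⟩
    n                                                                      ∎
    where
    open ≡-Reasoning
    removed-all : count {sumF k blocks} (λ _ → true) ≡ k * b
    removed-all = trans (count-true (sumF k blocks)) (trans (sumF≡sum k blocks) (sum-const k b))
  survivors-in : ∀ i → count (λ x → survives φ x ∧ ⌊ c x ≟ i ⌋) + demand i ≡ classSize c i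
  survivors-in i = trans (cong (_+_ (count (λ x → survives φ x ∧ ⌊ c x ≟ i ⌋))) removed-i)
    (count-survivors Φ Φ-injective (λ x → ⌊ c x ≟ i ⌋))
    where
    removed-i : demand i ≡ count (λ y → ⌊ c (Φ y) ≟ i ⌋)
    removed-i = trans (sym (κ-demand i)) (count-cong (λ y → cong (λ u → ⌊ u ≟ i ⌋) (sym (proj₂ (proj₂ embedding) y))))

-- A copy of type t has its z₁-class in class t of G.
bottleDemand : ∀ {ℓ} (z z₁ : ℕ) → (Fin ℓ → ℕ) → Fin ℓ → ℕ
bottleDemand z z₁ m i = sum (λ t → m t * (if ⌊ t ≟ i ⌋ then z₁ else z))

bottleDemand-+ : ∀ {ℓ} z₁ d (m : Fin ℓ → ℕ) i → bottleDemand (z₁ + d) z₁ m i + m i * d ≡ sum m * (z₁ + d)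
bottleDemand-+ z₁ d m i = begin
  bottleDemand (z₁ + d) z₁ m i + m i * d                                          ≡⟨ cong (_+_ (bottleDemand (z₁ + d) z₁ m i)) (sum-indicator (λ t → m t * d) i) ⟨
  bottleDemand (z₁ + d) z₁ m i + sum (λ t → if ⌊ t ≟ i ⌋ then m t * d else 0)   ≡⟨ ∑-distrib-+ (λ t → m t * (if ⌊ t ≟ i ⌋ then z₁ else z₁ + d)) _ ⟨
  sum (λ t → m t * (if ⌊ t ≟ i ⌋ then z₁ else z₁ + d) + (if ⌊ t ≟ i ⌋ then m t * d else 0)) ≡⟨ sum-cong-≗ (λ t → by-cases (m t) ⌊ t ≟ i ⌋) ⟩
  sum (λ t → m t * (z₁ + d))                                                      ≡⟨ *-distribʳ-sum (z₁ + d) m ⟨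
  sum m * (z₁ + d)                                                                ∎
  where
  open ≡-Reasoning
  by-cases : ∀ x b → x * (if b then z₁ else z₁ + d) + (if b then x * d else 0) ≡ x * (z₁ + d)
  by-cases x true  = sym (ℕ.*-distribˡ-+ x z₁ d)
  by-cases x false = ℕ.+-identityʳ _

bottleSizes-transpose : ∀ L z z₁ (t i : Fin (suc L)) →
  bottleSizes (suc L) z z₁ (transpose zero t ⟨$⟩ˡ i) ≡ (if ⌊ t ≟ i ⌋ then z₁ else z)
bottleSizes-transpose L z z₁ t i with t ≟ i
... | yes refl = cong (bottleSizes (suc L) z z₁) (PC.transpose-inverse t zero)
... | no t≢i with transpose zero t ⟨$⟩ˡ i in eq
...   | zero  = contradiction (trans (cong (transpose zero t ⟨$⟩ʳ_) (sym eq)) (inverseʳ (transpose zero t))) t≢i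
...   | suc _ = refl

bottleDemand-transposed : ∀ L z z₁ (m : Fin (suc L) → ℕ) i →
  sum (λ j → bottleSizes (suc L) z z₁ (transpose zero (classOf (suc L) m j) ⟨$⟩ˡ i)) ≡ bottleDemand z z₁ m i
bottleDemand-transposed L z z₁ m i = trans (sum-ι (suc L) m _) (sum-cong-≗ λ t → begin
  sum (λ v → size (classOf (suc L) m (ι (suc L) m t v)))  ≡⟨ sum-cong-≗ (λ v → cong size (classOf-ι (suc L) m t v)) ⟩
  sum {m t} (λ _ → size t)                               ≡⟨ sum-const (m t) (size t) ⟩
  m t * size t                                           ≡⟨ cong (m t *_) (bottleSizes-transpose L z z₁ t i) ⟩
  m t * (if ⌊ t ≟ i ⌋ then z₁ else z)                    ∎)
  where
  open ≡-Reasoning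
  size : Fin (suc L) → ℕ
  size t = bottleSizes (suc L) z z₁ (transpose zero t ⟨$⟩ˡ i)

pack-bottles : ∀ {L n} (z z₁ : ℕ) (m : Fin (suc L) → ℕ) (c : Fin n → Fin (suc L)) →
  let B = CompleteMultipartiteSizes (suc L) (bottleSizes (suc L) z z₁)
      k = sumF (suc L) m
  in (∀ i → bottleDemand z z₁ m i ≤ classSize c i) →
  Σ (Fin k → Fin (V B) → Fin n) λ φ →
    (∀ j → IsCopy B (CompleteMultipartite n (suc L) c) (φ j)) ×
    (∀ j j′ → j ≢ j′ → ∀ v v′ → φ j v ≢ φ j′ v′) ×
    (count (survives φ) + k * V B ≡ n) ×
    (∀ i → count (λ x → survives φ x ∧ ⌊ c x ≟ i ⌋) + bottleDemand z z₁ m i ≡ classSize c i)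
pack-bottles {L} z z₁ m c =
  pack-permuted-copies (bottleSizes (suc L) z z₁) (λ j → transpose zero (classOf (suc L) m j)) c
    (bottleDemand z z₁ m) (bottleDemand-transposed L z z₁ m)

-- The arithmetic of the deletion

bottle-order : ∀ L z z₁ → sumF (suc L) (bottleSizes (suc L) z z₁) ≡ z₁ + L * z
bottle-order L z z₁ = cong (_+_ z₁) (trans (sumF≡sum L (λ _ → z)) (sum-const L z))

z≤bottle-order : ∀ L′ z z₁ → z ≤ sumF (2 + L′) (bottleSizes (2 + L′) z z₁)
z≤bottle-order L′ z z₁ = ℕ.≤-trans (ℕ.m≤m+n z (sumF L′ (λ _ → z))) (ℕ.m≤n+m _ z₁)

cube-bound : ∀ L′ → 4 * suc L′ ≤ (2 + L′) ^ 3
cube-bound L′ = subst (4 * suc L′ ≤_) (sym (ring L′)) (ℕ.m≤m+n _ _)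
  where
  ring : ∀ L′ → (2 + L′) * ((2 + L′) * ((2 + L′) * 1)) ≡ 4 * suc L′ + (4 + 8 * L′ + 6 * (L′ * L′) + L′ * L′ * L′)
  ring = solve-∀

split-order : ∀ ℓ {b D′ n} .{{_ : NonZero b}} → b ∣ D′ → b ∣ n → 2 * ℓ * D′ ≤ n →
  Σ ℕ λ Q → n ≡ ℓ * D′ + Q * b × ℓ * D′ ≤ Q * b
split-order ℓ {b} (divides e refl) (divides q refl) 2ℓD′≤n =
  q ∸ ℓ * e , order , subst (_≤ (q ∸ ℓ * e) * b) (ℕ.*-assoc ℓ e b) (ℕ.*-monoˡ-≤ b ℓe≤Q)
  where
  2ℓe≤q : ℓ * e + ℓ * e ≤ q
  2ℓe≤q = ℕ.*-cancelʳ-≤ _ q b (subst (_≤ q * b) (ring ℓ e b) 2ℓD′≤n)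
    where
    ring : ∀ ℓ e b → 2 * ℓ * (e * b) ≡ (ℓ * e + ℓ * e) * b
    ring = solve-∀
  ℓe≤Q : ℓ * e ≤ q ∸ ℓ * e
  ℓe≤Q = ℕ.m+n≤o⇒m≤o∸n (ℓ * e) 2ℓe≤q
  order : q * b ≡ ℓ * (e * b) + (q ∸ ℓ * e) * b
  order = begin
    q * b                            ≡⟨ cong (_* b) (ℕ.m+[n∸m]≡n (ℕ.≤-trans (ℕ.m≤m+n (ℓ * e) (ℓ * e)) 2ℓe≤q)) ⟨
    (ℓ * e + (q ∸ ℓ * e)) * b        ≡⟨ ℕ.*-distribʳ-+ b (ℓ * e) (q ∸ ℓ * e) ⟩
    ℓ * e * b + (q ∸ ℓ * e) * b      ≡⟨ cong (_+ (q ∸ ℓ * e) * b) (ℕ.*-assoc ℓ e b) ⟩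
    ℓ * (e * b) + (q ∸ ℓ * e) * b    ∎
    where open ≡-Reasoning

-- u i = |U_i|. When n = ℓD′ + Q b, W is the target size of U_i, deficit i is a_i (0 for the
-- last class), and m i copies with their z₁-class in U_i are deleted.
module Balancing {L′ z₁ d : ℕ} .{{_ : NonZero d}} (D′ Q : ℕ) (u : Fin (2 + L′) → ℕ) where

  L ℓ z b W : ℕ
  L = suc L′
  ℓ = suc L
  z = z₁ + d
  b = sumF ℓ (bottleSizes ℓ z z₁)
  W = D′ + z * Q

  deficit : Fin ℓ → ℕ
  deficit i = if notLast i then W ∸ u i else 0

  m r : Fin ℓ → ℕ
  m i = deficit i / d
  r i = deficit i % d

  A k s : ℕ
  A = sum deficit
  k = sum m
  s = sum r

  instance
    z≢0 : NonZero z
    z≢0 = ℕ.>-nonZero (ℕ.≤-trans (ℕ.>-nonZero⁻¹ d) (ℕ.m≤n+m d z₁))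

  z≤b : z ≤ b
  z≤b = z≤bottle-order L′ z z₁

  deficit-notLast : ∀ i → suc (toℕ i) < ℓ → deficit i ≡ W ∸ u i
  deficit-notLast i i<L with notLast i | notLast-reflects i
  ... | true  | ofʸ _   = refl
  ... | false | ofⁿ i≮L = contradiction i<L i≮L

  deficit≡ : ∀ i → deficit i ≡ r i + m i * d
  deficit≡ i = ℕ.m≡m%n+[m/n]*n (deficit i) d

  A≡ : A ≡ s + k * d
  A≡ = trans (sum-cong-≗ deficit≡) (trans (∑-distrib-+ r (λ i → m i * d)) (cong (_+_ s) (sym (*-distribʳ-sum d m))))

  k≤A : k ≤ A
  k≤A = sum-mono-≤ (λ i → ℕ.m/n≤m (deficit i) d)

  r≤b : ∀ i → r i ≤ b
  r≤b i = ℕ.≤-trans (ℕ.m%n≤n (deficit i) d) (ℕ.≤-trans (ℕ.m≤n+m d z₁) z≤b)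

  s≤b : s ≤ b
  s≤b = begin
    s                                           ≤⟨ sum-mono-≤ r≤z ⟩
    sum {ℓ} (λ i → if notLast i then z else 0)  ≡⟨ sum-notLast-const L z ⟩
    L * z                                       ≤⟨ ℕ.m≤n+m (L * z) z₁ ⟩
    z₁ + L * z                                  ≡⟨ bottle-order L z z₁ ⟨
    b                                           ∎
    where
    open ℕ.≤-Reasoning
    r≤z : ∀ i → r i ≤ (if notLast i then z else 0)
    r≤z i with notLast i
    ... | true  = ℕ.≤-trans (ℕ.m%n≤n (W ∸ u i) d) (ℕ.m≤n+m d z₁)
    ... | false = ℕ.m%n≤m 0 d

  demand-last : bottleDemand z z₁ m (fromℕ L) ≡ k * z
  demand-last = begin
    bottleDemand z z₁ m (fromℕ L)                    ≡⟨ ℕ.+-identityʳ _ ⟨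
    bottleDemand z z₁ m (fromℕ L) + 0 * d            ≡⟨ cong (λ t → bottleDemand z z₁ m (fromℕ L) + t * d) m-last ⟨
    bottleDemand z z₁ m (fromℕ L) + m (fromℕ L) * d  ≡⟨ bottleDemand-+ z₁ d m (fromℕ L) ⟩
    k * z                                            ∎
    where
    open ≡-Reasoning
    deficit-last : deficit (fromℕ L) ≡ 0
    deficit-last with notLast (fromℕ L) | notLast-reflects (fromℕ L)
    ... | true  | ofʸ L<L = contradiction (subst (λ t → suc t < ℓ) (toℕ-fromℕ L) L<L) (ℕ.<-irrefl refl)
    ... | false | ofⁿ _   = refl
    m-last : m (fromℕ L) ≡ 0
    m-last = trans (cong (_/ d) deficit-last) (ℕ.0/n≡0 d)

  deficits-small : (∀ i → suc (toℕ i) < ℓ → (W ∸ u i) * (ℓ ^ 3 * b) ≤ 2 * Q) → 2 * z * A ≤ Q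
  deficits-small deficit≤ = ℕ.*-cancelʳ-≤ (2 * z * A) Q (2 * L) (begin
    2 * z * A * (2 * L)                               ≡⟨ ring₁ z A L ⟩
    A * (4 * L * z)                                   ≤⟨ ℕ.*-monoʳ-≤ A (ℕ.*-mono-≤ (cube-bound L′) z≤b) ⟩
    A * (ℓ ^ 3 * b)                                   ≡⟨ *-distribʳ-sum (ℓ ^ 3 * b) deficit ⟩
    sum (λ i → deficit i * (ℓ ^ 3 * b))               ≤⟨ sum-mono-≤ pointwise ⟩
    sum {ℓ} (λ i → if notLast i then 2 * Q else 0)    ≡⟨ sum-notLast-const L (2 * Q) ⟩
    L * (2 * Q)                                       ≡⟨ ring₂ L Q ⟩
    Q * (2 * L)                                       ∎)
    where
    open ℕ.≤-Reasoning
    pointwise : ∀ i → deficit i * (ℓ ^ 3 * b) ≤ (if notLast i then 2 * Q else 0)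
    pointwise i with notLast i | notLast-reflects i
    ... | true  | ofʸ i<L = deficit≤ i i<L
    ... | false | ofⁿ _   = z≤n
    ring₁ : ∀ z A L → 2 * z * A * (2 * L) ≡ A * (4 * L * z)
    ring₁ = solve-∀
    ring₂ : ∀ L Q → L * (2 * Q) ≡ Q * (2 * L)
    ring₂ = solve-∀

  module Balanced (u≤W : ∀ i → suc (toℕ i) < ℓ → u i ≤ W) (sum-u : sum u ≡ ℓ * D′ + Q * b) (small : 2 * z * A ≤ Q) where

    u+deficit : ∀ i → suc (toℕ i) < ℓ → u i + deficit i ≡ W
    u+deficit i i<L = trans (cong (_+_ (u i)) (deficit-notLast i i<L)) (ℕ.m+[n∸m]≡n (u≤W i i<L))

    last-class : u (fromℕ L) ≡ D′ + z₁ * Q + A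
    last-class = ℕ.+-cancelʳ-≡ (L * W) _ _ (begin
      u (fromℕ L) + L * W                          ≡⟨ cong (_+_ (u (fromℕ L))) (trans (sym (sum-notLast-const L W)) (sum-cong-≗ masked)) ⟩
      u (fromℕ L) + sum (λ i → uᵢ i + deficit i)   ≡⟨ cong (_+_ (u (fromℕ L))) (∑-distrib-+ uᵢ deficit) ⟩
      u (fromℕ L) + (sum uᵢ + A)                   ≡⟨ ring₁ (u (fromℕ L)) (sum uᵢ) A ⟩
      sum uᵢ + u (fromℕ L) + A                     ≡⟨ cong (_+ A) (trans (sym (sum-notLast L u)) sum-u) ⟩
      ℓ * D′ + Q * b + A                           ≡⟨ cong (λ t → ℓ * D′ + Q * t + A) (bottle-order L z z₁) ⟩
      ℓ * D′ + Q * (z₁ + L * z) + A                ≡⟨ ring₂ D′ z₁ Q A L z ⟩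
      D′ + z₁ * Q + A + L * W                      ∎)
      where
      open ≡-Reasoning
      uᵢ : Fin ℓ → ℕ
      uᵢ i = if notLast i then u i else 0
      masked : ∀ i → (if notLast i then W else 0) ≡ uᵢ i + deficit i
      masked i with notLast i | notLast-reflects i
      ... | true  | ofʸ i<L = sym (trans (cong (_+_ (u i)) (sym (deficit-notLast i i<L))) (u+deficit i i<L))
      ... | false | ofⁿ _   = refl
      ring₁ : ∀ x y a → x + (y + a) ≡ y + x + a
      ring₁ = solve-∀
      ring₂ : ∀ D′ z₁ Q A L z → suc L * D′ + Q * (z₁ + L * z) + A ≡ D′ + z₁ * Q + A + L * (D′ + z * Q)
      ring₂ = solve-∀

    k≤Q : k ≤ Q
    k≤Q = ℕ.≤-trans k≤A (ℕ.≤-trans (ℕ.≤-trans (ℕ.m≤n*m A z) (ℕ.*-monoˡ-≤ A (ℕ.m≤n*m z 2))) small)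

    kz+A≤W : k * z + A ≤ W
    kz+A≤W = begin
      k * z + A       ≤⟨ ℕ.+-monoˡ-≤ A (ℕ.*-monoˡ-≤ z k≤A) ⟩
      A * z + A       ≤⟨ ℕ.+-monoʳ-≤ (A * z) (ℕ.m≤m*n A z) ⟩
      A * z + A * z   ≡⟨ ring z A ⟩
      2 * z * A       ≤⟨ small ⟩
      Q               ≤⟨ ℕ.m≤n*m Q z ⟩
      z * Q           ≤⟨ ℕ.m≤n+m (z * Q) D′ ⟩
      W               ∎
      where
      open ℕ.≤-Reasoning
      ring : ∀ z A → A * z + A * z ≡ 2 * z * A
      ring = solve-∀

    demand≤u : ∀ i → bottleDemand z z₁ m i ≤ u i
    demand≤u i with notLast-or-last i
    ... | inj₁ i<L = ℕ.+-cancelʳ-≤ (deficit i) _ _ (begin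
      bottleDemand z z₁ m i + deficit i      ≤⟨ ℕ.+-mono-≤ (ℕ.m≤m+n _ (m i * d)) (term≤sum deficit i) ⟩
      bottleDemand z z₁ m i + m i * d + A    ≡⟨ cong (_+ A) (bottleDemand-+ z₁ d m i) ⟩
      k * z + A                              ≤⟨ kz+A≤W ⟩
      W                                      ≡⟨ u+deficit i i<L ⟨
      u i + deficit i                        ∎)
      where open ℕ.≤-Reasoning
    ... | inj₂ refl = begin
      bottleDemand z z₁ m (fromℕ L)   ≡⟨ demand-last ⟩
      k * (z₁ + d)                    ≡⟨ ℕ.*-distribˡ-+ k z₁ d ⟩
      k * z₁ + k * d                  ≤⟨ ℕ.+-mono-≤ (ℕ.*-monoˡ-≤ z₁ k≤Q) (ℕ.m≤n+m (k * d) s) ⟩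
      Q * z₁ + (s + k * d)            ≡⟨ cong₂ _+_ (ℕ.*-comm Q z₁) (sym A≡) ⟩
      z₁ * Q + A                      ≤⟨ ℕ.+-monoˡ-≤ A (ℕ.m≤n+m (z₁ * Q) D′) ⟩
      D′ + z₁ * Q + A                 ≡⟨ last-class ⟨
      u (fromℕ L)                     ∎
      where open ℕ.≤-Reasoning

    residual-notLast : ∀ i → suc (toℕ i) < ℓ → ∀ x → x + bottleDemand z z₁ m i ≡ u i → x + r i ≡ D′ + z * (Q ∸ k)
    residual-notLast i i<L x x+demand≡u = ℕ.+-cancelʳ-≡ (k * z) _ _ (begin
      x + r i + k * z                                 ≡⟨ cong (_+_ (x + r i)) (bottleDemand-+ z₁ d m i) ⟨
      x + r i + (bottleDemand z z₁ m i + m i * d)     ≡⟨ ring₁ x (r i) (bottleDemand z z₁ m i) (m i * d) ⟩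
      (x + bottleDemand z z₁ m i) + (r i + m i * d)   ≡⟨ cong₂ _+_ x+demand≡u (sym (deficit≡ i)) ⟩
      u i + deficit i                                 ≡⟨ u+deficit i i<L ⟩
      D′ + z * Q                                      ≡⟨ cong (λ t → D′ + z * t) (ℕ.m∸n+n≡m k≤Q) ⟨
      D′ + z * (Q ∸ k + k)                            ≡⟨ ring₂ D′ z (Q ∸ k) k ⟩
      D′ + z * (Q ∸ k) + k * z                        ∎)
      where
      open ≡-Reasoning
      ring₁ : ∀ x r e f → x + r + (e + f) ≡ (x + e) + (r + f)
      ring₁ = solve-∀
      ring₂ : ∀ D′ z a k → D′ + z * (a + k) ≡ D′ + z * a + k * z
      ring₂ = solve-∀

    residual-last : ∀ x → x + bottleDemand z z₁ m (fromℕ L) ≡ u (fromℕ L) → x ≡ D′ + z₁ * (Q ∸ k) + s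
    residual-last x x+demand≡u = ℕ.+-cancelʳ-≡ (k * z) _ _ (begin
      x + k * z                                   ≡⟨ cong (_+_ x) demand-last ⟨
      x + bottleDemand z z₁ m (fromℕ L)           ≡⟨ x+demand≡u ⟩
      u (fromℕ L)                                 ≡⟨ last-class ⟩
      D′ + z₁ * Q + A                             ≡⟨ cong₂ (λ t a → D′ + z₁ * t + a) (sym (ℕ.m∸n+n≡m k≤Q)) A≡ ⟩
      D′ + z₁ * (Q ∸ k + k) + (s + k * d)         ≡⟨ ring D′ z₁ (Q ∸ k) k s d ⟩
      D′ + z₁ * (Q ∸ k) + s + k * z               ∎)
      where
      open ≡-Reasoning
      ring : ∀ D′ z₁ a k s d → D′ + z₁ * (a + k) + (s + k * d) ≡ D′ + z₁ * a + s + k * (z₁ + d)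
      ring = solve-∀

ℤ→ℚ-homo-sub : ∀ x y → ℤ→ℚ x ℚ.- ℤ→ℚ y ℚ.≃ ℤ→ℚ (x ℤ.- y)
ℤ→ℚ-homo-sub x y = *≡* (ring x y)
  where
  ring : ∀ x y → (x ℤ.* + 1 ℤ.+ ℤ.- y ℤ.* + 1) ℤ.* + 1 ≡ (x ℤ.- y) ℤ.* + 1
  ring = ℤ-Solver.solve-∀

ℕ→ℚ-homo-+ : ∀ x y → ℕ→ℚ x ℚ.+ ℕ→ℚ y ℚ.≃ ℕ→ℚ (x + y)
ℕ→ℚ-homo-+ x y = *≡* (trans (ring (+ x) (+ y)) (cong (ℤ._* + 1) (sym (ℤ.pos-+ x y))))
  where
  ring : ∀ x y → (x ℤ.* + 1 ℤ.+ y ℤ.* + 1) ℤ.* + 1 ≡ (x ℤ.+ y) ℤ.* + 1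
  ring = ℤ-Solver.solve-∀

ℕ→ℚ-homo-* : ∀ x y → ℕ→ℚ x ℚ.* ℕ→ℚ y ℚ.≃ ℕ→ℚ (x * y)
ℕ→ℚ-homo-* x y = *≡* (cong (ℤ._* + 1) (sym (ℤ.pos-* x y)))

ℕ→ℚ-mono-≤ : ∀ {x y} → x ≤ y → ℕ→ℚ x ℚ.≤ ℕ→ℚ y
ℕ→ℚ-mono-≤ {x} {y} x≤y = *≤* (subst₂ ℤ._≤_ (sym (ℤ.*-identityʳ (+ x))) (sym (ℤ.*-identityʳ (+ y))) (ℤ.+≤+ x≤y))

ΣQ-ℕ→ℚ : ∀ {n} (f : Fin n → ℚᵘ) (g : Fin n → ℕ) → (∀ i → f i ℚ.≃ ℕ→ℚ (g i)) → ΣQ f ℚ.≃ ℕ→ℚ (sum g)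
ΣQ-ℕ→ℚ {zero}  f g f≃g = ℚ.≃-refl
ΣQ-ℕ→ℚ {suc n} f g f≃g = ℚ.≃-trans (ℚ.+-cong (f≃g zero) (ΣQ-ℕ→ℚ (f ∘ suc) (g ∘ suc) (f≃g ∘ suc))) (ℕ→ℚ-homo-+ (g zero) _)

frac-exact : ∀ y w b .{{_ : NonZero b}} → y ≡ w ℤ.* + b → frac y b ℚ.≃ ℤ→ℚ w
frac-exact y w (suc b) refl = *≡* (ring w (+ suc b))
  where
  ring : ∀ w b → (w ℤ.* b) ℤ.* + 1 ≡ w ℤ.* b
  ring = ℤ-Solver.solve-∀

0≤⊖⇒≤ : ∀ w u → 0ℚᵘ ℚ.≤ ℤ→ℚ (w ⊖ u) → u ≤ w
0≤⊖⇒≤ w u (*≤* 0≤w⊖u) with u ℕ.≤? w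
... | yes u≤w = u≤w
... | no  u≰w = contradiction (subst (λ x → + 0 ℤ.≤ x ℤ.* + 1) (ℤ.⊖-≰ u≰w) 0≤w⊖u) (¬0≤neg (ℕ.m<n⇒0<n∸m (ℕ.≰⇒> u≰w)))
  where
  ¬0≤neg : ∀ {k} → 0 < k → ¬ (+ 0 ℤ.≤ ℤ.- + k ℤ.* + 1)
  ¬0≤neg {suc k} _ ()

≤frac⇒*≤ : ∀ a n t .{{_ : NonZero t}} → ℕ→ℚ a ℚ.≤ frac (+ n) t → a * t ≤ n
≤frac⇒*≤ a n (suc t) (*≤* a*t≤n) = ℤ.drop‿+≤+ (subst₂ ℤ._≤_ (sym (ℤ.pos-* a (suc t))) (ℤ.*-identityʳ (+ n)) a*t≤n)

frac<⇒*< : ∀ a d ℓ → frac (+ a) d ℚ.< ℕ→ℚ ℓ → a < ℓ * suc (ℕ.pred d)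
frac<⇒*< a d ℓ (*<* a<ℓd) = ℤ.drop‿+<+ (subst₂ ℤ._<_ (ℤ.*-identityʳ (+ a)) (sym (ℤ.pos-* ℓ (suc (ℕ.pred d)))) a<ℓd)

∣⊖∣-below : ∀ {x r t b} → x + r ≡ t → r ≤ b → ℤ.∣ x ⊖ t ∣ ≤ b
∣⊖∣-below {x} {r} refl r≤b = subst (_≤ _) (sym (trans (ℤ.∣⊖∣-≤ (ℕ.m≤m+n x r)) (ℕ.m+n∸m≡n x r))) r≤b

∣⊖∣-above : ∀ {x s b} t → x ≡ t + s → s ≤ b → ℤ.∣ x ⊖ t ∣ ≤ b
∣⊖∣-above {x} {s} t x≡t+s s≤b = subst (_≤ _) (ℤ.∣m⊖n∣≡∣n⊖m∣ t x) (∣⊖∣-below (sym x≡t+s) s≤b)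

-- The value that u_i − D′ should have: Z = z, or z₁ for the last class.
target : (Z ℓ D′ n b : ℕ) → ℚᵘ
target Z ℓ D′ n b = frac (+ Z ℤ.* (+ n ℤ.- + (ℓ * D′))) b

target-exact : ∀ Z ℓ D′ P b .{{_ : NonZero b}} → target Z ℓ D′ (ℓ * D′ + P * b) b ℚ.≃ ℕ→ℚ (Z * P)
target-exact Z ℓ D′ P b = frac-exact _ (+ (Z * P)) b (begin
  + Z ℤ.* (+ (ℓ * D′ + P * b) ℤ.- + (ℓ * D′))         ≡⟨ cong (λ x → + Z ℤ.* (x ℤ.- + (ℓ * D′))) (trans (ℤ.pos-+ (ℓ * D′) (P * b)) (cong (ℤ._+_ (+ (ℓ * D′))) (ℤ.pos-* P b))) ⟩
  + Z ℤ.* (+ (ℓ * D′) ℤ.+ + P ℤ.* + b ℤ.- + (ℓ * D′))  ≡⟨ ring (+ Z) (+ (ℓ * D′)) (+ P) (+ b) ⟩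
  + Z ℤ.* + P ℤ.* + b                                  ≡⟨ cong (ℤ._* + b) (ℤ.pos-* Z P) ⟨
  + (Z * P) ℤ.* + b                                    ∎)
  where
  open ≡-Reasoning
  ring : ∀ z x p b → z ℤ.* (x ℤ.+ p ℤ.* b ℤ.- x) ≡ z ℤ.* p ℤ.* b
  ring = ℤ-Solver.solve-∀

deficit-exact : ∀ z ℓ D′ Q b u .{{_ : NonZero b}} →
  target z ℓ D′ (ℓ * D′ + Q * b) b ℚ.- ℤ→ℚ (+ u ℤ.- + D′) ℚ.≃ ℤ→ℚ ((D′ + z * Q) ⊖ u)
deficit-exact z ℓ D′ Q b u = ℚ.≃-trans (ℚ.+-congˡ (ℚ.- ℤ→ℚ (+ u ℤ.- + D′)) (target-exact z ℓ D′ Q b))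
  (ℚ.≃-trans (ℤ→ℚ-homo-sub (+ (z * Q)) (+ u ℤ.- + D′)) (ℚ.≃-reflexive (cong ℤ→ℚ (begin
    + (z * Q) ℤ.- (+ u ℤ.- + D′)   ≡⟨ ring (+ (z * Q)) (+ u) (+ D′) ⟩
    + D′ ℤ.+ + (z * Q) ℤ.- + u     ≡⟨ cong (ℤ._- + u) (ℤ.pos-+ D′ (z * Q)) ⟨
    + (D′ + z * Q) ℤ.- + u         ≡⟨ ℤ.[+m]-[+n]≡m⊖n (D′ + z * Q) u ⟩
    (D′ + z * Q) ⊖ u               ∎))))
  where
  open ≡-Reasoning
  ring : ∀ t u d → t ℤ.- (u ℤ.- d) ≡ d ℤ.+ t ℤ.- u
  ring = ℤ-Solver.solve-∀

deviation-exact : ∀ Z ℓ D′ P b u .{{_ : NonZero b}} →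
  ℤ→ℚ (+ u ℤ.- + D′) ℚ.- target Z ℓ D′ (ℓ * D′ + P * b) b ℚ.≃ ℤ→ℚ (u ⊖ (D′ + Z * P))
deviation-exact Z ℓ D′ P b u = ℚ.≃-trans (ℚ.+-congʳ (ℤ→ℚ (+ u ℤ.- + D′)) (ℚ.-‿cong (target-exact Z ℓ D′ P b)))
  (ℚ.≃-trans (ℤ→ℚ-homo-sub (+ u ℤ.- + D′) (+ (Z * P))) (ℚ.≃-reflexive (cong ℤ→ℚ (begin
    + u ℤ.- + D′ ℤ.- + (Z * P)     ≡⟨ ring (+ u) (+ D′) (+ (Z * P)) ⟩
    + u ℤ.- (+ D′ ℤ.+ + (Z * P))   ≡⟨ cong (ℤ._-_ (+ u)) (ℤ.pos-+ D′ (Z * P)) ⟨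
    + u ℤ.- + (D′ + Z * P)         ≡⟨ ℤ.[+m]-[+n]≡m⊖n u (D′ + Z * P) ⟩
    u ⊖ (D′ + Z * P)               ∎))))
  where
  open ≡-Reasoning
  ring : ∀ u d t → u ℤ.- d ℤ.- t ≡ u ℤ.- (d ℤ.+ t)
  ring = ℤ-Solver.solve-∀

near-target : ∀ Z ℓ D′ P b u {n} .{{_ : NonZero b}} → n ≡ ℓ * D′ + P * b → ℤ.∣ u ⊖ (D′ + Z * P) ∣ ≤ b →
  ℚ.∣ ℤ→ℚ (+ u ℤ.- + D′) ℚ.- target Z ℓ D′ n b ∣ ℚ.≤ ℕ→ℚ b
near-target Z ℓ D′ P b u refl close =
  ℚ.≤-respˡ-≃ (ℚ.∣-∣-cong (ℚ.≃-sym (deviation-exact Z ℓ D′ P b u))) (ℕ→ℚ-mono-≤ close)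

-- The critical chromatic number

proper-colouring-≤1 : (H : Graph) → V H ≤ 1 → ProperColouring H 1 (λ _ → zero)
proper-colouring-≤1 H V≤1 x y xy _ = E-irrefl H (subst (E H x) (sym (all-equal V≤1 x y)) xy)
  where
  all-equal : ∀ {n} → n ≤ 1 → (x y : Fin n) → x ≡ y
  all-equal {suc zero}    _        zero zero = refl
  all-equal {suc (suc _)} (s≤s ()) _    _

chromatic⇒2≤V : ∀ (H : Graph) L → IsChromaticNumber H (2 + L) → 2 ≤ V H
chromatic⇒2≤V H L (_ , not-fewer) with 2 ℕ.≤? V H
... | yes 2≤V = 2≤V
... | no  2≰V = contradiction (_ , proper-colouring-≤1 H (ℕ.≤-pred (ℕ.≰⇒> 2≰V))) (not-fewer 1 (s≤s (s≤s z≤n)))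

-- frac p 0 is p / 1, so for z = |H| − σ = 0 the hypothesis reads (ℓ − 1)|H| < ℓ, which
-- forces |H| ≤ 1 and so contradicts χ(H) ≥ 2.
χcr<ℓ⇒z₁<z : ∀ (H : Graph) L σ → IsChromaticNumber H (2 + L) → χcr H (2 + L) σ ℚ.< ℕ→ℚ (2 + L) → suc L * σ < V H ∸ σ
χcr<ℓ⇒z₁<z H L σ χ χcr<ℓ = cleared (V H ∸ σ) refl (frac<⇒*< (suc L * V H) (V H ∸ σ) (2 + L) χcr<ℓ)
  where
  cleared : ∀ z → V H ∸ σ ≡ z → suc L * V H < (2 + L) * suc (ℕ.pred z) → suc L * σ < z
  cleared zero    _  ineq = contradiction ineq (ℕ.≤⇒≯ (begin
    (2 + L) * 1   ≡⟨ ℕ.*-identityʳ (2 + L) ⟩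
    2 + L         ≤⟨ ℕ.m≤m+n (2 + L) L ⟩
    2 + L + L     ≡⟨ ring L ⟩
    suc L * 2     ≤⟨ ℕ.*-monoʳ-≤ (suc L) (chromatic⇒2≤V H L χ) ⟩
    suc L * V H   ∎))
    where
    open ℕ.≤-Reasoning
    ring : ∀ L → 2 + L + L ≡ suc L * 2
    ring = solve-∀
  cleared (suc w) z≡ ineq = ℕ.+-cancelʳ-< (suc L * suc w) (suc L * σ) (suc w) (begin-strict
    suc L * σ + suc L * suc w   ≡⟨ ℕ.*-distribˡ-+ (suc L) σ (suc w) ⟨
    suc L * (σ + suc w)         ≡⟨ cong (suc L *_) (trans (cong (_+_ σ) (sym z≡)) (ℕ.m+[n∸m]≡n σ≤V)) ⟩
    suc L * V H                 <⟨ ineq ⟩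
    (2 + L) * suc w             ≡⟨ ring L (suc w) ⟩
    suc w + suc L * suc w       ∎)
    where
    open ℕ.≤-Reasoning
    σ≤V : σ ≤ V H
    σ≤V = ℕ.<⇒≤ (ℕ.m∸n≢0⇒n<m (λ z≡0 → ℕ.1+n≢0 (trans (sym z≡) z≡0)))
    ring : ∀ L w → (2 + L) * w ≡ w + suc L * w
    ring = solve-∀

deficitℚ : ∀ {n} (ℓ z D′ b : ℕ) → (Fin n → Fin ℓ) → Fin ℓ → ℚᵘ
deficitℚ {n} ℓ z D′ b c i = target z ℓ D′ n b ℚ.- ℤ→ℚ (+ classSize c i ℤ.- + D′)

SmallDeficits : ∀ {n} (ℓ z D′ b : ℕ) → (Fin n → Fin ℓ) → Set
SmallDeficits {n} ℓ z D′ b c = ∀ i → suc (toℕ i) < ℓ →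
  (0ℚᵘ ℚ.≤ deficitℚ ℓ z D′ b c i) × (deficitℚ ℓ z D′ b c i ℚ.≤ frac (+ n) (ℓ ^ 3 * b ^ 2))

BalancingDeletion : ∀ {n} (ℓ z z₁ D′ : ℕ) → (Fin n → Fin ℓ) → Set
BalancingDeletion {n} ℓ z z₁ D′ c =
  let B = CompleteMultipartiteSizes ℓ (bottleSizes ℓ z z₁)
      b = V B
  in ∃[ k ] Σ (Fin k → Fin b → Fin n) λ φ →
    (ℕ→ℚ k ℚ.≤ ℕ→ℚ (ℓ ^ 2) ℚ.* ΣQ (λ i → if notLast i then deficitℚ ℓ z D′ b c i else 0ℚᵘ)) ×
    (∀ j → IsCopy B (CompleteMultipartite n ℓ c) (φ j)) ×
    (∀ j j′ → j ≢ j′ → ∀ v v′ → φ j v ≢ φ j′ v′) ×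
    (let nS = count (survives φ)
         uS = λ i → count (λ x → survives φ x ∧ ⌊ c x ≟ i ⌋)
     in (∀ i → suc (toℕ i) < ℓ → ℚ.∣ ℤ→ℚ (+ uS i ℤ.- + D′) ℚ.- target z ℓ D′ nS b ∣ ℚ.≤ ℕ→ℚ b) ×
        (∀ i → suc (toℕ i) ≡ ℓ → ℚ.∣ ℤ→ℚ (+ uS i ℤ.- + D′) ℚ.- target z₁ ℓ D′ nS b ∣ ℚ.≤ ℕ→ℚ b))

BottleDeletion : (ℓ z z₁ : ℕ) → Set
BottleDeletion ℓ z z₁ =
  let b = sumF ℓ (bottleSizes ℓ z z₁)
  in (D′ : ℕ) → b ∣ D′ → ∃[ N ] ((n : ℕ) (c : Fin n → Fin ℓ) → N ≤ n → b ∣ n →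
       SmallDeficits ℓ z D′ b c → BalancingDeletion ℓ z z₁ D′ c)

deficits-in-ℕ : ∀ ℓ z D′ Q b .{{_ : NonZero ℓ}} .{{_ : NonZero b}} (c : Fin (ℓ * D′ + Q * b) → Fin ℓ) →
  ℓ * D′ ≤ Q * b → SmallDeficits ℓ z D′ b c → ∀ i → suc (toℕ i) < ℓ →
  classSize c i ≤ D′ + z * Q × (D′ + z * Q ∸ classSize c i) * (ℓ ^ 3 * b) ≤ 2 * Q
deficits-in-ℕ ℓ z D′ Q b c ℓD′≤Qb small i i<ℓ = u≤W , ℕ.*-cancelʳ-≤ _ (2 * Q) b (begin
  (W ∸ u) * (ℓ ^ 3 * b) * b   ≡⟨ ring₁ (W ∸ u) (ℓ ^ 3) b ⟩
  (W ∸ u) * (ℓ ^ 3 * b ^ 2)   ≤⟨ ≤frac⇒*≤ (W ∸ u) _ (ℓ ^ 3 * b ^ 2) {{ℕ.m*n≢0 (ℓ ^ 3) (b ^ 2) {{ℕ.m^n≢0 ℓ 3}} {{ℕ.m^n≢0 b 2}}}} deficit≤ ⟩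
  ℓ * D′ + Q * b              ≤⟨ ℕ.+-monoˡ-≤ (Q * b) ℓD′≤Qb ⟩
  Q * b + Q * b               ≡⟨ ring₂ Q b ⟩
  2 * Q * b                   ∎)
  where
  open ℕ.≤-Reasoning
  u W : ℕ
  u = classSize c i
  W = D′ + z * Q
  a≃ : deficitℚ ℓ z D′ b c i ℚ.≃ ℤ→ℚ (W ⊖ u)
  a≃ = deficit-exact z ℓ D′ Q b u
  u≤W : u ≤ W
  u≤W = 0≤⊖⇒≤ W u (ℚ.≤-respʳ-≃ a≃ (proj₁ (small i i<ℓ)))
  deficit≤ : ℕ→ℚ (W ∸ u) ℚ.≤ frac (+ (ℓ * D′ + Q * b)) (ℓ ^ 3 * b ^ 2)
  deficit≤ = ℚ.≤-respˡ-≃ (ℚ.≃-trans a≃ (ℚ.≃-reflexive (cong ℤ→ℚ (ℤ.⊖-≥ u≤W)))) (proj₂ (small i i<ℓ))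
  ring₁ : ∀ x y b → x * (y * b) * b ≡ x * (y * (b * (b * 1)))
  ring₁ = solve-∀
  ring₂ : ∀ Q b → Q * b + Q * b ≡ 2 * Q * b
  ring₂ = solve-∀

ΣQ-deficits : ∀ ℓ z D′ Q b .{{_ : NonZero b}} (c : Fin (ℓ * D′ + Q * b) → Fin ℓ) →
  (∀ i → suc (toℕ i) < ℓ → classSize c i ≤ D′ + z * Q) →
  ΣQ (λ i → if notLast i then deficitℚ ℓ z D′ b c i else 0ℚᵘ) ℚ.≃ ℕ→ℚ (sum (λ i → if notLast i then D′ + z * Q ∸ classSize c i else 0))
ΣQ-deficits ℓ z D′ Q b c u≤W = ΣQ-ℕ→ℚ _ _ pointwise
  where
  pointwise : ∀ i → (if notLast i then deficitℚ ℓ z D′ b c i else 0ℚᵘ) ℚ.≃ ℕ→ℚ (if notLast i then D′ + z * Q ∸ classSize c i else 0)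
  pointwise i with notLast i | notLast-reflects i
  ... | true  | ofʸ i<ℓ = ℚ.≃-trans (deficit-exact z ℓ D′ Q b (classSize c i)) (ℚ.≃-reflexive (cong ℤ→ℚ (ℤ.⊖-≥ (u≤W i i<ℓ))))
  ... | false | ofⁿ _   = ℚ.≃-refl

balancing-deletion : ∀ L′ z₁ d .{{_ : NonZero d}} (D′ Q : ℕ) {n} →
  let ℓ = 2 + L′
      b = sumF ℓ (bottleSizes ℓ (z₁ + d) z₁)
  in n ≡ ℓ * D′ + Q * b → ℓ * D′ ≤ Q * b → (c : Fin n → Fin ℓ) →
     SmallDeficits ℓ (z₁ + d) D′ b c → BalancingDeletion ℓ (z₁ + d) z₁ D′ c
balancing-deletion L′ z₁ d D′ Q refl ℓD′≤Qb c small =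
  sumF ℓ m , φ , k-bound , proj₁ (proj₂ packing) , proj₁ (proj₂ (proj₂ packing)) , near-notLast , near-last
  where
  open Balancing {L′} {z₁} {d} D′ Q (classSize c)
  instance
    b≢0 : NonZero b
    b≢0 = ℕ.>-nonZero (ℕ.≤-trans (ℕ.>-nonZero⁻¹ z) z≤b)
  u≤W : ∀ i → suc (toℕ i) < ℓ → classSize c i ≤ W
  u≤W i i<ℓ = proj₁ (deficits-in-ℕ ℓ z D′ Q b c ℓD′≤Qb small i i<ℓ)
  2zA≤Q : 2 * z * A ≤ Q
  2zA≤Q = deficits-small (λ i i<ℓ → proj₂ (deficits-in-ℕ ℓ z D′ Q b c ℓD′≤Qb small i i<ℓ))
  open Balanced u≤W (sum-classSize c) 2zA≤Q
  packing = pack-bottles z z₁ m c demand≤u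
  φ = proj₁ packing
  uS : Fin ℓ → ℕ
  uS i = count (λ x → survives φ x ∧ ⌊ c x ≟ i ⌋)
  survivors-in : ∀ i → uS i + bottleDemand z z₁ m i ≡ classSize c i
  survivors-in = proj₂ (proj₂ (proj₂ (proj₂ packing)))
  survivors : count (survives φ) ≡ ℓ * D′ + (Q ∸ k) * b
  survivors = ℕ.+-cancelʳ-≡ (k * b) _ _ (begin
    count (survives φ) + k * b          ≡⟨ cong (λ t → count (survives φ) + t * b) (sumF≡sum ℓ m) ⟨
    count (survives φ) + sumF ℓ m * b   ≡⟨ proj₁ (proj₂ (proj₂ (proj₂ packing))) ⟩
    ℓ * D′ + Q * b                      ≡⟨ cong (λ t → ℓ * D′ + t * b) (ℕ.m∸n+n≡m k≤Q) ⟨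
    ℓ * D′ + (Q ∸ k + k) * b            ≡⟨ cong (_+_ (ℓ * D′)) (ℕ.*-distribʳ-+ b (Q ∸ k) k) ⟩
    ℓ * D′ + ((Q ∸ k) * b + k * b)      ≡⟨ ℕ.+-assoc (ℓ * D′) _ _ ⟨
    ℓ * D′ + (Q ∸ k) * b + k * b        ∎)
    where open ≡-Reasoning
  near-notLast : ∀ i → suc (toℕ i) < ℓ → ℚ.∣ ℤ→ℚ (+ uS i ℤ.- + D′) ℚ.- target z ℓ D′ (count (survives φ)) b ∣ ℚ.≤ ℕ→ℚ b
  near-notLast i i<ℓ = near-target z ℓ D′ (Q ∸ k) b (uS i) survivors
    (∣⊖∣-below (residual-notLast i i<ℓ (uS i) (survivors-in i)) (r≤b i))
  near-last : ∀ i → suc (toℕ i) ≡ ℓ → ℚ.∣ ℤ→ℚ (+ uS i ℤ.- + D′) ℚ.- target z₁ ℓ D′ (count (survives φ)) b ∣ ℚ.≤ ℕ→ℚ b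
  near-last i i≡ℓ = subst (λ (j : Fin ℓ) → ℚ.∣ ℤ→ℚ (+ uS j ℤ.- + D′) ℚ.- target z₁ ℓ D′ (count (survives φ)) b ∣ ℚ.≤ ℕ→ℚ b)
    (sym (≡⇒last i i≡ℓ))
    (near-target z₁ ℓ D′ (Q ∸ k) b (uS (fromℕ L)) survivors
      (∣⊖∣-above (D′ + z₁ * (Q ∸ k)) (residual-last (uS (fromℕ L)) (survivors-in (fromℕ L))) s≤b))
  k-bound : ℕ→ℚ (sumF ℓ m) ℚ.≤ ℕ→ℚ (ℓ ^ 2) ℚ.* ΣQ (λ i → if notLast i then deficitℚ ℓ z D′ b c i else 0ℚᵘ)
  k-bound = ℚ.≤-respʳ-≃ (ℚ.≃-sym (ℚ.≃-trans (ℚ.*-congˡ (ΣQ-deficits ℓ z D′ Q b c u≤W)) (ℕ→ℚ-homo-* (ℓ ^ 2) A)))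
    (ℕ→ℚ-mono-≤ (subst (_≤ ℓ ^ 2 * A) (sym (sumF≡sum ℓ m)) (ℕ.≤-trans k≤A (ℕ.m≤n*m A (ℓ ^ 2)))))

bottle-deletion : ∀ L′ z₁ d .{{_ : NonZero d}} → BottleDeletion (2 + L′) (z₁ + d) z₁
bottle-deletion L′ z₁ d D′ b∣D′ = 2 * (2 + L′) * D′ , λ n c N≤n b∣n →
  let (Q , n≡ , ℓD′≤Qb) = split-order (2 + L′) {{b≢0}} b∣D′ b∣n N≤n
  in balancing-deletion L′ z₁ d D′ Q n≡ ℓD′≤Qb c
  where
  b≢0 : NonZero (sumF (2 + L′) (bottleSizes (2 + L′) (z₁ + d) z₁))
  b≢0 = ℕ.>-nonZero (ℕ.≤-trans (ℕ.>-nonZero⁻¹ d) (ℕ.≤-trans (ℕ.m≤n+m d z₁) (z≤bottle-order L′ (z₁ + d) z₁)))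

lemma19 : (H : Graph) (ℓ σ : ℕ) → 2 ≤ ℓ → IsChromaticNumber H ℓ → IsSigma H ℓ σ →
    χcr H ℓ σ ℚ.< ℕ→ℚ ℓ →
    let z = V H ∸ σ
        z1 = (ℓ ∸ 1) * σ
        B = Bottle H ℓ σ
        b = V B
    in (D' : ℕ) → b ∣ D' →
    ∃[ N ] ((n : ℕ) (c : Fin n → Fin ℓ) → N ≤ n → b ∣ n →
      let G = CompleteMultipartite n ℓ c
          a = λ (i : Fin ℓ) → frac (+ z ℤ.* (+ n ℤ.- + (ℓ * D'))) b ℚ.- ℤ→ℚ (+ classSize c i ℤ.- + D')
      in (∀ i → suc (toℕ i) < ℓ → (0ℚᵘ ℚ.≤ a i) × (a i ℚ.≤ frac (+ n) (ℓ ^ 3 * b ^ 2))) →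
      ∃[ k ] Σ (Fin k → Fin b → Fin n) (λ φ →
        (ℕ→ℚ k ℚ.≤ ℕ→ℚ (ℓ ^ 2) ℚ.* ΣQ (λ i → if suc (toℕ i) <ᵇ ℓ then a i else 0ℚᵘ)) ×
        (∀ j → IsCopy B G (φ j)) ×
        (∀ j j' → j ≢ j' → ∀ v v' → φ j v ≢ φ j' v') ×
        (let nS = count (survives φ)
             uS = λ (i : Fin ℓ) → count (λ x → survives φ x ∧ ⌊ c x ≟ i ⌋)
         in (∀ i → suc (toℕ i) < ℓ →
               ℚ.∣ ℤ→ℚ (+ uS i ℤ.- + D') ℚ.- frac (+ z ℤ.* (+ nS ℤ.- + (ℓ * D'))) b ∣ ℚ.≤ ℕ→ℚ b) ×
            (∀ i → suc (toℕ i) ≡ ℓ →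
               ℚ.∣ ℤ→ℚ (+ uS i ℤ.- + D') ℚ.- frac (+ z1 ℤ.* (+ nS ℤ.- + (ℓ * D'))) b ∣ ℚ.≤ ℕ→ℚ b))))
lemma19 H (suc (suc L′)) σ (s≤s (s≤s z≤n)) χ _ χcr<ℓ =
  subst (λ z → BottleDeletion (2 + L′) z z₁) (ℕ.m+[n∸m]≡n (ℕ.<⇒≤ z₁<z))
    (bottle-deletion L′ z₁ (V H ∸ σ ∸ z₁) {{ℕ.>-nonZero (ℕ.m<n⇒0<n∸m z₁<z)}})
  where
  z₁ : ℕ
  z₁ = suc L′ * σ
  z₁<z : z₁ < V H ∸ σ
  z₁<z = χcr<ℓ⇒z₁<z H L′ σ χ χcr<ℓ
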